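{- Let $G$ be a connected graph. Then $A(G)\le Dim(G)$.
   Context: Graphs are simple and connected, with at least two vertices; $d$ is the shortest-path distance. A set $S\subseteq V(G)$ is a $k$-metric generator if for every pair of distinct vertices $u,v$ there are at least $k$ vertices $w\in S$ with $d(u,w)\neq d(v,w)$; $Dim(G)=k$ means $k$ is the largest integer such that a $k$-metric generator exists. A geodesic is a shortest path; it is maximal if it is not contained in a longer geodesic. For distinct vertices $v,w$, $\gamma(v,w)$ denotes a maximal geodesic containing $v$ and $w$, and $|\gamma(v,w)|$ its length. $A(G)=\inf_{v\neq w}|\gamma(v,w)|$, i.e. the length of the shortest maximal geodesic in $G$. -}

module Defs where

open import Data.Nat using (ℕ; zero; suc; _≤_; _<_)
open import Data.Fin using (Fin)
open import Data.Bool using (Bool; true; false)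
open import Data.List using (List; []; _∷_; length)
open import Data.List.Relation.Binary.Infix.Heterogeneous using (Infix)
open import Data.Product using (Σ; ∃; _×_; _,_)
open import Function using (Injective)
open import Relation.Nullary using (¬_)
open import Relation.Binary.PropositionalEquality using (_≡_; _≢_)

record Graph : Set where
  field
    n         : ℕ
    two≤n     : 2 ≤ n
    E         : Fin n → Fin n → Bool
    E-sym     : ∀ u v → E u v ≡ E v u
    E-irrefl  : ∀ v → E v v ≡ false

  V : Set
  V = Fin n

  Adj : V → V → Set
  Adj u v = E u v ≡ true

  data Walk : V → V → ℕ → Set where
    here : ∀ v → Walk v v 0
    step : ∀ {u w v k} → Adj u w → Walk w v k → Walk u v (suc k)

  vertices : ∀ {u v k} → Walk u v k → List V
  vertices (here v)         = v ∷ []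
  vertices (step {u} _ p)   = u ∷ vertices p

  -- d(u,v) ≡ k, stated relationally: k is the least length of a u–v walk
  IsDist : V → V → ℕ → Set
  IsDist u v k = Walk u v k × (∀ m → Walk u v m → k ≤ m)

Connected : Graph → Set
Connected G = ∀ u v → ∃ λ k → Walk u v k
  where open Graph G

module _ (G : Graph) where
  open Graph G

  Resolves : V → V → V → Set
  Resolves w u v = ∀ a b → IsDist u w a → IsDist v w b → a ≢ b

  -- S is a k-metric generator: every pair of distinct vertices is
  -- distinguished by at least k (distinct) vertices of S.
  IsKMetricGenerator : ℕ → (V → Set) → Set
  IsKMetricGenerator k S =
    ∀ u v → u ≢ v →
      Σ (Fin k → V) λ f → Injective _≡_ _≡_ f ×
        (∀ i → S (f i) × Resolves (f i) u v)

  IsDim : ℕ → Set₁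
  IsDim k = (∃ λ S → IsKMetricGenerator k S) ×
            (∀ k′ → (∃ λ S → IsKMetricGenerator k′ S) → k′ ≤ k)

  record Geodesic : Set where
    constructor geodesic
    field
      start end : V
      len       : ℕ
      walk      : Walk start end len
      shortest  : ∀ m → Walk start end m → len ≤ m

  -- P is contained in Q: the vertex sequence of P is a contiguous
  -- segment of that of Q
  _⊑_ : Geodesic → Geodesic → Set
  P ⊑ Q = Infix _≡_ (vertices (Geodesic.walk P)) (vertices (Geodesic.walk Q))

  IsMaximal : Geodesic → Set
  IsMaximal P = ∀ Q → P ⊑ Q → ¬ (Geodesic.len P < Geodesic.len Q)

  IsA : ℕ → Set
  IsA a = (Σ Geodesic λ P → IsMaximal P × Geodesic.len P ≡ a) ×
          (∀ P → IsMaximal P → a ≤ Geodesic.len P)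

-- Let u ≠ v. Extend a shortest u–v path to a maximal geodesic q₀ … q_L; then L ≥ A(G), and
-- u = qᵢ, v = qⱼ for some i ≠ j. Along a geodesic d(q_m, q_p) = |m − p|, so q_m fails to resolve
-- u and v only if |i − m| = |j − m|, i.e. only if m is the midpoint of i and j. Hence at least
-- L ≥ A(G) vertices resolve u and v, the whole vertex set is an A(G)-metric generator, and
-- A(G) ≤ Dim(G). Maximality is not decidable, so the maximal extension is only obtained under
-- a double negation; this suffices because "A(G) ≤ number of resolving vertices" is decidable.

module Submission where

open import Defs
open import Data.Nat using (_≤_)
open import Data.Nat using (ℕ; zero; suc; _<_; _+_; _∸_; ∣_-_∣; z≤n; s≤s; _≤?_; _≟_)
open import Data.Nat.Properties
open import Data.Nat.Induction using (<-rec)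
open import Data.Fin as Fin using (Fin; toℕ; fromℕ<; punchIn; inject₁; inject≤)
open import Data.Fin.Properties
  using (any?; injective⇒≤; toℕ-injective; toℕ<n; toℕ≤pred[n]; toℕ-fromℕ<;
         punchIn-injective; punchInᵢ≢i; inject₁-injective; inject≤-injective)
open import Data.Bool as Bool using (true)
open import Data.List using (List; length; filter; allFin; lookup)
import Data.List.Relation.Binary.Infix.Heterogeneous as Infix
import Data.List.Relation.Binary.Infix.Heterogeneous.Properties as Infix
import Data.List.Relation.Binary.Prefix.Heterogeneous as Prefix
import Data.List.Relation.Binary.Pointwise as Pointwise
import Data.List.Relation.Unary.All as All
import Data.List.Relation.Unary.Any as Any
open import Data.List.Relation.Unary.Any.Properties using (lookup-index)
open import Data.List.Relation.Unary.AllPairs using (_∷_)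
open import Data.List.Relation.Unary.Unique.Propositional using (Unique)
import Data.List.Relation.Unary.Unique.Propositional.Properties as Unique
open import Data.List.Membership.Propositional using (_∈_)
open import Data.List.Membership.Propositional.Properties using (∈-filter⁺; ∈-filter⁻; ∈-allFin; ∈-lookup)
open import Data.Product using (Σ; ∃; _×_; _,_; proj₁; proj₂)
open import Data.Sum using (inj₁; inj₂)
open import Data.Unit using (⊤; tt)
open import Data.Empty using (⊥-elim)
open import Relation.Nullary using (¬_; Dec; yes; no; contradiction)
open import Relation.Nullary.Decidable using (_×-dec_; ¬?; decidable-stable)
open import Relation.Unary using (Decidable)
open import Relation.Binary using (tri<; tri≈; tri>)
open import Relation.Binary.PropositionalEquality
open import Function using (Injective; _∘_)

private
  variable
    A : Set

m+m≡n+n⇒m≡n : ∀ {m n} → m + m ≡ n + n → m ≡ n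
m+m≡n+n⇒m≡n {m} {n} eq with <-cmp m n
... | tri< m<n _ _ = contradiction eq (<⇒≢ (+-mono-< m<n m<n))
... | tri≈ _ m≡n _ = m≡n
... | tri> _ _ n<m = contradiction (sym eq) (<⇒≢ (+-mono-< n<m n<m))

private
  midpoint : ∀ {i j m} → i ≤ m → m ≤ j → m ∸ i ≡ j ∸ m → m + m ≡ i + j
  midpoint {i} {j} {m} i≤m m≤j eq = begin
    m + m             ≡⟨ cong (_+ m) (sym (m+[n∸m]≡n i≤m)) ⟩
    i + (m ∸ i) + m   ≡⟨ +-assoc i (m ∸ i) m ⟩
    i + (m ∸ i + m)   ≡⟨ cong (λ x → i + (x + m)) eq ⟩
    i + (j ∸ m + m)   ≡⟨ cong (i +_) (m∸n+n≡m m≤j) ⟩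
    i + j             ∎
    where open ≡-Reasoning

∣i-m∣≡∣j-m∣⇒m+m≡i+j : ∀ {i j m} → i ≢ j → ∣ i - m ∣ ≡ ∣ j - m ∣ → m + m ≡ i + j
∣i-m∣≡∣j-m∣⇒m+m≡i+j {i} {j} {m} i≢j eq with ≤-total i m | ≤-total j m
... | inj₁ i≤m | inj₁ j≤m = contradiction
  (∸-cancelˡ-≡ i≤m j≤m (trans (sym (m≤n⇒∣m-n∣≡n∸m i≤m)) (trans eq (m≤n⇒∣m-n∣≡n∸m j≤m)))) i≢j
... | inj₂ m≤i | inj₂ m≤j = contradiction
  (∸-cancelʳ-≡ m≤i m≤j (trans (sym (m≤n⇒∣n-m∣≡n∸m m≤i)) (trans eq (m≤n⇒∣n-m∣≡n∸m m≤j)))) i≢j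
... | inj₁ i≤m | inj₂ m≤j = midpoint i≤m m≤j
  (trans (sym (m≤n⇒∣m-n∣≡n∸m i≤m)) (trans eq (m≤n⇒∣n-m∣≡n∸m m≤j)))
... | inj₂ m≤i | inj₁ j≤m = trans (midpoint j≤m m≤i
  (trans (sym (m≤n⇒∣m-n∣≡n∸m j≤m)) (trans (sym eq) (m≤n⇒∣n-m∣≡n∸m m≤i)))) (+-comm j i)

Unique⇒lookup-injective : {xs : List A} → Unique xs → Injective _≡_ _≡_ (lookup xs)
Unique⇒lookup-injective (_ ∷ _) {Fin.zero} {Fin.zero} _ = refl
Unique⇒lookup-injective (x∉ ∷ _) {Fin.zero} {Fin.suc j} eq = ⊥-elim (All.lookup x∉ (∈-lookup j) eq)
Unique⇒lookup-injective (x∉ ∷ _) {Fin.suc i} {Fin.zero} eq =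
  ⊥-elim (All.lookup x∉ (∈-lookup i) (sym eq))
Unique⇒lookup-injective (_ ∷ u) {Fin.suc i} {Fin.suc j} eq =
  cong Fin.suc (Unique⇒lookup-injective u eq)

injection-into⇒≤length : ∀ {c} {xs : List A} (f : Fin c → A) →
  Injective _≡_ _≡_ f → (∀ i → f i ∈ xs) → c ≤ length xs
injection-into⇒≤length {xs = xs} f f-inj f∈xs = injective⇒≤ {f = Any.index ∘ f∈xs} index-inj
  where
    index-inj : Injective _≡_ _≡_ (Any.index ∘ f∈xs)
    index-inj {i} {j} eq = f-inj (trans (lookup-index (f∈xs i))
                                 (trans (cong (lookup xs) eq) (sym (lookup-index (f∈xs j)))))

≤length⇒injection-into : ∀ {c} {xs : List A} → Unique xs → c ≤ length xs →
  Σ (Fin c → A) λ f → Injective _≡_ _≡_ f × (∀ i → f i ∈ xs)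
≤length⇒injection-into {xs = xs} xs! c≤ =
  lookup xs ∘ inject ,
  (λ eq → inject≤-injective c≤ c≤ _ _ (Unique⇒lookup-injective xs! eq)) ,
  ∈-lookup ∘ inject
  where
    inject : Fin _ → Fin (length xs)
    inject i = inject≤ i c≤

avoid-subsingleton : ∀ {L} (B : Fin (suc L) → Set) → Decidable B → (∀ {x y} → B x → B y → x ≡ y) →
  Σ (Fin L → Fin (suc L)) λ f → Injective _≡_ _≡_ f × (∀ i → ¬ B (f i))
avoid-subsingleton B B? B-unique with any? B?
... | yes (b , Bb) = punchIn b , punchIn-injective b _ _ , λ i Bi → punchInᵢ≢i b i (B-unique Bi Bb)
... | no ¬∃B       = inject₁ , inject₁-injective , λ i Bi → ¬∃B (inject₁ i , Bi)

module Walks (G : Graph) where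
  open Graph G

  Adj-sym : ∀ {u v} → Adj u v → Adj v u
  Adj-sym {u} {v} = trans (E-sym v u)

  Adj? : ∀ u v → Dec (Adj u v)
  Adj? u v = E u v Bool.≟ true

  infixr 5 _++ʷ_
  _++ʷ_ : ∀ {u w v k l} → Walk u w k → Walk w v l → Walk u v (k + l)
  here _   ++ʷ q = q
  step a p ++ʷ q = step a (p ++ʷ q)

  reverse : ∀ {u v k} → Walk u v k → Walk v u k
  reverse (here v) = here v
  reverse {k = suc k} (step {u} a p) =
    subst (Walk _ u) (+-comm k 1) (reverse p ++ʷ step (Adj-sym a) (here u))

  Walk? : ∀ u v k → Dec (Walk u v k)
  Walk? u v zero with u Fin.≟ v
  ... | yes refl = yes (here u)
  ... | no u≢v   = no λ { (here _) → u≢v refl }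
  Walk? u v (suc k) with any? (λ w → Adj? u w ×-dec Walk? w v k)
  ... | yes (_ , a , p) = yes (step a p)
  ... | no ¬first-step  = no λ { (step a p) → ¬first-step (_ , a , p) }

  IsDist-unique : ∀ {u v a b} → IsDist u v a → IsDist u v b → a ≡ b
  IsDist-unique (p , p-least) (q , q-least) = ≤-antisym (p-least _ q) (q-least _ p)

  IsDist-sym : ∀ {u v k} → IsDist u v k → IsDist v u k
  IsDist-sym (p , p-least) = reverse p , λ m q → p-least m (reverse q)

  IsDist-refl : ∀ {v} → IsDist v v 0
  IsDist-refl = here _ , λ _ _ → z≤n

  Walk⇒IsDist : ∀ {u v} K → Walk u v K → ∃ (IsDist u v)
  Walk⇒IsDist {u} {v} = <-rec (λ K → Walk u v K → ∃ (IsDist u v)) go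
    where
      go : ∀ K → (∀ {m} → m < K → Walk u v m → ∃ (IsDist u v)) → Walk u v K → ∃ (IsDist u v)
      go K shorter p with any? (λ (i : Fin K) → Walk? u v (toℕ i))
      ... | yes (i , q) = shorter (toℕ<n i) q
      ... | no ¬shorter = K , p , λ m q → ≮⇒≥ λ m<K →
              ¬shorter (fromℕ< m<K , subst (Walk u v) (sym (toℕ-fromℕ< m<K)) q)

  at : ∀ {s t L} → Walk s t L → ℕ → V
  at (here v)       _       = v
  at (step {u} _ _) zero    = u
  at (step _ q)     (suc m) = at q m

  takeʷ : ∀ {s t L} (q : Walk s t L) m → m ≤ L → Walk s (at q m) m
  takeʷ (here v)   zero    _         = here v
  takeʷ (step a q) zero    _         = here _
  takeʷ (step a q) (suc m) (s≤s m≤L) = step a (takeʷ q m m≤L)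

  dropʷ : ∀ {s t L} (q : Walk s t L) m → m ≤ L → Walk (at q m) t (L ∸ m)
  dropʷ (here v)   zero    _         = here v
  dropʷ (step a q) zero    _         = step a q
  dropʷ (step a q) (suc m) (s≤s m≤L) = dropʷ q m m≤L

  at-dropʷ : ∀ {s t L} (q : Walk s t L) m (m≤L : m ≤ L) k → at (dropʷ q m m≤L) k ≡ at q (m + k)
  at-dropʷ (here v)   zero    _         _ = refl
  at-dropʷ (step a q) zero    _         _ = refl
  at-dropʷ (step a q) (suc m) (s≤s m≤L) k = at-dropʷ q m m≤L k

  prefix⇒ends : ∀ {s t L s′ t′ k} (p : Walk s′ t′ k) (q : Walk s t L) →
    Prefix.Prefix _≡_ (vertices p) (vertices q) → k ≤ L × at q 0 ≡ s′ × at q k ≡ t′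
  prefix⇒ends (here v)   (here w)   (refl Prefix.∷ _) = z≤n , refl , refl
  prefix⇒ends (here v)   (step b q) (refl Prefix.∷ _) = z≤n , refl , refl
  prefix⇒ends (step a (here _))   (here w) (refl Prefix.∷ ())
  prefix⇒ends (step a (step _ _)) (here w) (refl Prefix.∷ ())
  prefix⇒ends (step a p) (step b q) (refl Prefix.∷ pre) with prefix⇒ends p q pre
  ... | k≤L , _ , ends = s≤s k≤L , refl , ends

  infix⇒ends : ∀ {s t L s′ t′ k} (p : Walk s′ t′ k) (q : Walk s t L) →
    Infix.Infix _≡_ (vertices p) (vertices q) → ∃ λ i → i + k ≤ L × at q i ≡ s′ × at q (i + k) ≡ t′
  infix⇒ends p          q@(here _)   (Infix.here pre) = 0 , prefix⇒ends p q pre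
  infix⇒ends p          q@(step _ _) (Infix.here pre) = 0 , prefix⇒ends p q pre
  infix⇒ends (here v)   (here w)   (Infix.there (Infix.here ()))
  infix⇒ends (step a p) (here w)   (Infix.there (Infix.here ()))
  infix⇒ends p          (step b q) (Infix.there inf) with infix⇒ends p q inf
  ... | i , i+k≤L , ends = suc i , s≤s i+k≤L , ends

  middle-shortest : ∀ {s x y t a b c L} → (∀ m → Walk s t m → L ≤ m) → a + b + c ≤ L →
    Walk s x a → Walk y t c → ∀ m → Walk x y m → b ≤ m
  middle-shortest {a = a} {b} {c} {L} shortest abc≤L pre suf m p =
    +-cancelʳ-≤ c b m (+-cancelˡ-≤ a (b + c) (m + c) (begin
      a + (b + c)  ≡⟨ +-assoc a b c ⟨
      a + b + c    ≤⟨ abc≤L ⟩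
      L            ≤⟨ shortest _ (pre ++ʷ p ++ʷ suf) ⟩
      a + (m + c)  ∎))
    where open ≤-Reasoning

  module Shortest {s t L} (q : Walk s t L) (shortest : ∀ m → Walk s t m → L ≤ m) where

    segment-IsDist : ∀ {m p} → m ≤ p → p ≤ L → IsDist (at q m) (at q p) (p ∸ m)
    segment-IsDist {m} {p} m≤p p≤L = subst (λ x → Walk (at q m) x (p ∸ m)) ends segment , least
      where
        m≤L : m ≤ L
        m≤L = ≤-trans m≤p p≤L
        segment : Walk (at q m) (at (dropʷ q m m≤L) (p ∸ m)) (p ∸ m)
        segment = takeʷ (dropʷ q m m≤L) (p ∸ m) (∸-monoˡ-≤ m p≤L)
        ends : at (dropʷ q m m≤L) (p ∸ m) ≡ at q p
        ends = trans (at-dropʷ q m m≤L (p ∸ m)) (cong (at q) (m+[n∸m]≡n m≤p))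
        split : m + (p ∸ m) + (L ∸ p) ≤ L
        split = ≤-reflexive (trans (cong (_+ (L ∸ p)) (m+[n∸m]≡n m≤p)) (m+[n∸m]≡n p≤L))
        least : ∀ k → Walk (at q m) (at q p) k → p ∸ m ≤ k
        least = middle-shortest shortest split (takeʷ q m m≤L) (dropʷ q p p≤L)

    position-IsDist : ∀ {m p} → m ≤ L → p ≤ L → IsDist (at q m) (at q p) ∣ m - p ∣
    position-IsDist {m} {p} m≤L p≤L with ≤-total m p
    ... | inj₁ m≤p = subst (IsDist _ _) (sym (m≤n⇒∣m-n∣≡n∸m m≤p)) (segment-IsDist m≤p p≤L)
    ... | inj₂ p≤m =
      subst (IsDist _ _) (sym (m≤n⇒∣n-m∣≡n∸m p≤m)) (IsDist-sym (segment-IsDist p≤m m≤L))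

    vertex : Fin (suc L) → V
    vertex i = at q (toℕ i)

    vertex-injective : Injective _≡_ _≡_ vertex
    vertex-injective {i} {j} eq = toℕ-injective (∣m-n∣≡0⇒m≡n (IsDist-unique
      (subst (λ x → IsDist (vertex i) x _) (sym eq) (position-IsDist (toℕ≤pred[n] i) (toℕ≤pred[n] j)))
      IsDist-refl))

    length<n : L < n
    length<n = injective⇒≤ vertex-injective

module Geodesics (G : Graph) where
  open Graph G
  open Walks G
  open Geodesic

  ⊑-refl : ∀ {P} → _⊑_ G P P
  ⊑-refl = Infix.fromPointwise (Pointwise.refl refl)

  ⊑-trans : ∀ {P Q R} → _⊑_ G P Q → _⊑_ G Q R → _⊑_ G P R
  ⊑-trans = Infix.trans trans

  ⊑⇒ends : ∀ {P Q} → _⊑_ G P Q →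
    ∃ λ i → i + len P ≤ len Q × at (walk Q) i ≡ start P × at (walk Q) (i + len P) ≡ end P
  ⊑⇒ends {P} {Q} = infix⇒ends (walk P) (walk Q)

  len<n : ∀ P → len P < n
  len<n P = Shortest.length<n (walk P) (shortest P)

  ¬¬-maximal-extension : ∀ t P → n ≤ t + len P → ¬ ¬ (∃ λ Q → _⊑_ G P Q × IsMaximal G Q)
  ¬¬-maximal-extension zero    P n≤len _    = <⇒≱ (len<n P) n≤len
  ¬¬-maximal-extension (suc t) P n≤t+len ¬ext = ¬ext (P , ⊑-refl {P} , maximal)
    where
      maximal : IsMaximal G P
      maximal Q P⊑Q len-P<Q = ¬¬-maximal-extension t Q
        (≤-trans n≤t+len (≤-trans (≤-reflexive (sym (+-suc t (len P)))) (+-monoʳ-≤ t len-P<Q)))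
        λ (R , Q⊑R , R-max) → ¬ext (R , ⊑-trans {P} {Q} {R} P⊑Q Q⊑R , R-max)

module ConnectedGraph (G : Graph) (connected : Connected G) where
  open Graph G
  open Walks G
  open Geodesic

  dist-IsDist : ∀ u v → ∃ (IsDist u v)
  dist-IsDist u v = Walk⇒IsDist _ (proj₂ (connected u v))

  dist : V → V → ℕ
  dist u v = proj₁ (dist-IsDist u v)

  IsDist⇒≡dist : ∀ {u v k} → IsDist u v k → dist u v ≡ k
  IsDist⇒≡dist = IsDist-unique (proj₂ (dist-IsDist _ _))

  geodesic-between : V → V → Geodesic G
  geodesic-between u v = let k , p , least = dist-IsDist u v in geodesic u v k p least

  Separates : V → V → V → Set
  Separates u v w = dist u w ≢ dist v w

  Separates? : ∀ u v → Decidable (Separates u v)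
  Separates? u v w = ¬? (dist u w ≟ dist v w)

  resolvers : V → V → List V
  resolvers u v = filter (Separates? u v) (allFin n)

  Separates⇒Resolves : ∀ {u v w} → Separates u v w → Resolves G w u v
  Separates⇒Resolves sep _ _ dᵤ dᵥ eq =
    sep (trans (IsDist⇒≡dist dᵤ) (trans eq (sym (IsDist⇒≡dist dᵥ))))

  ≤resolvers⇒generator : ∀ {c} → (∀ u v → u ≢ v → c ≤ length (resolvers u v)) →
    IsKMetricGenerator G c (λ _ → ⊤)
  ≤resolvers⇒generator c≤ u v u≢v
    with ≤length⇒injection-into (Unique.filter⁺ (Separates? u v) (Unique.allFin⁺ n)) (c≤ u v u≢v)
  ... | f , f-inj , f∈ = f , f-inj , λ i →
          tt , Separates⇒Resolves (proj₂ (∈-filter⁻ (Separates? u v) {xs = allFin n} (f∈ i)))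

  shortest-walk-resolvers : ∀ {s t L} (q : Walk s t L) → (∀ m → Walk s t m → L ≤ m) →
    ∀ {i j} → i ≤ L → j ≤ L → at q i ≢ at q j → L ≤ length (resolvers (at q i) (at q j))
  shortest-walk-resolvers {L = L} q shortest {i} {j} i≤L j≤L qᵢ≢qⱼ =
    count (avoid-subsingleton Equidistant Equidistant? Equidistant-unique)
    where
      open Shortest q shortest
      Equidistant : Fin (suc L) → Set
      Equidistant m = ∣ i - toℕ m ∣ ≡ ∣ j - toℕ m ∣
      Equidistant? : Decidable Equidistant
      Equidistant? m = ∣ i - toℕ m ∣ ≟ ∣ j - toℕ m ∣
      i≢j : i ≢ j
      i≢j = qᵢ≢qⱼ ∘ cong (at q)
      Equidistant-unique : ∀ {m m′} → Equidistant m → Equidistant m′ → m ≡ m′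
      Equidistant-unique eq eq′ = toℕ-injective (m+m≡n+n⇒m≡n
        (trans (∣i-m∣≡∣j-m∣⇒m+m≡i+j i≢j eq) (sym (∣i-m∣≡∣j-m∣⇒m+m≡i+j i≢j eq′))))
      separates : ∀ m → ¬ Equidistant m → Separates (at q i) (at q j) (vertex m)
      separates m ¬eq eq = ¬eq (trans (sym (IsDist⇒≡dist (position-IsDist i≤L (toℕ≤pred[n] m))))
                               (trans eq (IsDist⇒≡dist (position-IsDist j≤L (toℕ≤pred[n] m)))))
      count : (Σ (Fin L → Fin (suc L)) λ f → Injective _≡_ _≡_ f × (∀ k → ¬ Equidistant (f k))) →
        L ≤ length (resolvers (at q i) (at q j))
      count (f , f-inj , f-avoids) = injection-into⇒≤length (vertex ∘ f) (f-inj ∘ vertex-injective)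
        λ k → ∈-filter⁺ (Separates? _ _) (∈-allFin _) (separates (f k) (f-avoids k))

  ⊑⇒len≤resolvers : ∀ {P Q} → _⊑_ G P Q → start P ≢ end P →
    len Q ≤ length (resolvers (start P) (end P))
  ⊑⇒len≤resolvers {P@(geodesic _ _ k _ _)} {Q} P⊑Q s≢t with Geodesics.⊑⇒ends G {P} {Q} P⊑Q
  ... | i , i+k≤L , refl , refl =
          shortest-walk-resolvers (walk Q) (shortest Q) (≤-trans (m≤m+n i k) i+k≤L) i+k≤L s≢t

proposition2p21 : (G : Graph) → Connected G →
    ∀ a k → IsA G a → IsDim G k → a ≤ k
proposition2p21 G connected a k (_ , a-least) (_ , k-greatest) =
  k-greatest a ((λ _ → ⊤) , ≤resolvers⇒generator a≤resolvers)
  where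
    open Graph G
    open Geodesics G
    open ConnectedGraph G connected
    a≤resolvers : ∀ u v → u ≢ v → a ≤ length (resolvers u v)
    a≤resolvers u v u≢v = decidable-stable (a ≤? length (resolvers u v)) λ a≰ →
      ¬¬-maximal-extension n (geodesic-between u v) (m≤m+n n _) λ (Q , uv⊑Q , Q-max) →
        a≰ (≤-trans (a-least Q Q-max) (⊑⇒len≤resolvers {geodesic-between u v} {Q} uv⊑Q u≢v))
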